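{- For every natural number $d>1$ and every $\varepsilon>0$ there are $L,D>0$ such that the following holds. Let $G=(V_1,V_2,E)$ be a bipartite graph and let $u_1,\ldots,u_L\in V_1$ be such that $S_i:=N(u_i)\setminus\bigcup_{j<i}N(u_j)$ satisfies $|S_i|\ge D$ for all $i\in[L]$. If $W\subset V_2$ is chosen uniformly at random among all subsets of $V_2$, then with probability at least $1-\varepsilon$ the following holds: for every pair $(k,m)$ of integers with $0\le k\le m$ and $2\le m\le d$ there is $i\in[L]$ such that $|N(u_i)\cap W|\equiv k\pmod m$.
   Context: A bipartite graph $G=(V_1,V_2,E)$ has disjoint finite vertex classes and $E\subset V_1\times V_2$; $N(u)$ denotes the neighbourhood of $u$. -}

module Defs where

open import Data.Nat using (ℕ; zero; suc; _≤_; z≤n; s≤s)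
open import Data.Nat.Properties using (_≟_; _≤?_)
import Data.Nat.Divisibility as ℕD
open import Data.Integer using (ℤ; +_; _-_)
import Data.Integer.Divisibility as ℤD
open import Data.Bool using (Bool; true; false)
open import Data.Fin using (Fin; _<_; _<?_)
open import Data.Fin.Properties using (any?; all?)
open import Data.Fin.Subset using (Subset; _∩_; ∁; ⋃; ∣_∣; inside; outside)
open import Data.Vec using (Vec; []; _∷_; tabulate)
open import Data.List using (List; []; _∷_; _++_; map; filter; length)
open import Data.List.Base using (allFin)
open import Data.Product using (∃; ∃-syntax; _,_; _×_)
open import Relation.Nullary using (Dec; yes; no; ¬_)
open import Relation.Nullary.Decidable using (¬?)
open import Relation.Unary using (Decidable; Pred)
open import Relation.Nullary.Decidable as Dec using (_→-dec_)
open import Relation.Binary.PropositionalEquality using (refl)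
open import Data.Sum using (inj₁; inj₂)
import Data.Nat.Properties as NP

record BipartiteGraph : Set where
  field
    n₁ n₂ : ℕ
    adj   : Fin n₁ → Fin n₂ → Bool

  V₁ : Set
  V₁ = Fin n₁

  N : Fin n₁ → Subset n₂
  N u = tabulate (adj u)

open BipartiteGraph public

S : (G : BipartiteGraph) {L : ℕ} → (Fin L → Fin (n₁ G)) → Fin L → Subset (n₂ G)
S G {L} u i = N G (u i) ∩ ∁ (⋃ (map (λ j → N G (u j)) (filter (_<? i) (allFin L))))

_≡_[mod_] : ℕ → ℕ → ℕ → Set
x ≡ k [mod m ] = (+ m) ℤD.∣ (+ x - + k)

_≡?_[mod_] : ∀ x k m → Dec (x ≡ k [mod m ])
x ≡? k [mod m ] = m ℕD.∣? _

allSubsets : ∀ n → List (Subset n)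
allSubsets zero    = [] ∷ []
allSubsets (suc n) = map (outside ∷_) (allSubsets n) ++ map (inside ∷_) (allSubsets n)

Good : (d : ℕ) (G : BipartiteGraph) {L : ℕ} → (Fin L → Fin (n₁ G)) → Subset (n₂ G) → Set
Good d G {L} u W =
  ∀ (k m : ℕ) → k ≤ m → 2 ≤ m → m ≤ d →
  ∃[ i ] (∣ N G (u i) ∩ W ∣ ≡ k [mod m ])

private
  infixr 2 _⟶?_
  _⟶?_ : ∀ {A B : Set} → Dec A → Dec B → Dec (A → B)
  _⟶?_ = _→-dec_

  bounded? : ∀ {P : ℕ → Set} → (∀ m → Dec (P m)) → ∀ n → Dec (∀ m → m ≤ n → P m)
  bounded? P? zero with P? zero
  ... | yes p = yes λ { zero z≤n → p }
  ... | no ¬p = no λ h → ¬p (h zero z≤n)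
  bounded? P? (suc n) with bounded? P? n | P? (suc n)
  ... | no ¬h | _ = no λ h → ¬h λ m m≤n → h m (NP.m≤n⇒m≤1+n m≤n)
  ... | yes h | no ¬p = no λ h' → ¬p (h' (suc n) NP.≤-refl)
  ... | yes h | yes p = yes aux
    where
      aux : ∀ m → m ≤ suc n → _
      aux m m≤ with NP.m≤n⇒m<n∨m≡n m≤
      ... | inj₁ (s≤s m≤n) = h m m≤n
      ... | inj₂ refl = p

good? : ∀ d G {L} (u : Fin L → Fin (n₁ G)) W → Dec (Good d G u W)
good? d G u W =
  Dec.map′ to from
    (bounded? (λ k → bounded? (λ m → k ≤? m ⟶? 2 ≤? m ⟶? m ≤? d ⟶?
       any? (λ i → ∣ N G (u i) ∩ W ∣ ≡? k [mod m ])) d) d)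
  where
    to : _ → Good d G u W
    to h k m k≤m 2≤m m≤d = h k (NP.≤-trans k≤m m≤d) m m≤d k≤m 2≤m m≤d
    from : Good d G u W → _
    from g k _ m _ k≤m 2≤m m≤d = g k m k≤m 2≤m m≤d

#bad : ∀ d G {L} (u : Fin L → Fin (n₁ G)) → ℕ
#bad d G u = length (filter (λ W → ¬? (good? d G u W)) (allSubsets (n₂ G)))

-- Fix k and 2 ≤ m ≤ d. Whatever W does on the neighbourhoods N(u_j), j < i, the at least d
-- vertices of S_i are fair coins independent of it, and adding them one at a time moves
-- ∣N(u_i) ∩ W∣ through d + 1 ≥ m consecutive values. So, conditioned on what happens at all u_j
-- with j < i, ∣N(u_i) ∩ W∣ ≡ k (mod m) with probability at least 2⁻ᵈ, and no i works with
-- probability at most (1 − 2⁻ᵈ)^L. A union bound over the (d + 1)d pairs (k, m) and Bernoulli's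
-- inequality (1 + 1/p)^L ≥ 1 + L/p for p = 2ᵈ − 1 show that L = p(d + 1)d b and D = d work for
-- ε = a/b. Probabilities are counts of subsets of V₂ throughout.

module Submission where

open import Defs
open import Data.Bool using (Bool; true; false; _∧_; _∨_; not; T; if_then_else_)
open import Data.Bool.ListAction using (any)
open import Data.Bool.Properties using (T-∧; T-∨; T-≡; T-not-≡; ∧-distribˡ-∨)
open import Data.Empty using (⊥-elim)
open import Data.Fin as Fin using (Fin; toℕ; inject₁; fromℕ; _<?_)
open import Data.Fin.Properties using (toℕ-inject₁; toℕ-fromℕ; inject₁ℕ<; any?)
open import Data.Fin.Subset using (Subset; inside; outside; _∩_; ∁; ⋃; ∣_∣; _⊆_)
open import Data.Fin.Subset.Properties
  using (drop-∷-⊆; ⊆-antisym; p∩q⊆p; p∩q⊆q; x∈p∩q⁺; ∩-assoc; p⊆p∪q; q⊆p∪q; x∈∁p⇒x∉p; x∉p⇒x∈∁p)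
import Data.Integer as ℤ
open import Data.Integer.Divisibility.Signed using (_∣_; ∣ᵤ⇒∣; ∣⇒∣ᵤ; ∣-refl; ∣m∣n⇒∣m-n; ∣m⇒∣m*n)
open import Data.Integer.Properties using (pos-+; pos-*)
open import Data.Integer.Tactic.RingSolver using (solve-∀)
open import Data.List using (List; []; _∷_; _++_; map; filter; length; upTo)
open import Data.List.Membership.Propositional using (lose) renaming (_∈_ to _∈ˡ_)
open import Data.List.Membership.Propositional.Properties
  using (∈-map⁺; ∈-filter⁺; ∈-allFin; ∈-upTo⁺; ∈-upTo⁻)
open import Data.List.Properties using (filter-++; length-++; length-applyUpTo)
import Data.List.Relation.Unary.Any as Any
open import Data.List.Relation.Unary.Any.Properties using (any⁺)
open import Data.Nat using (ℕ; zero; suc; pred; _+_; _*_; _^_; _≤_; _<_; z≤n; s≤s; NonZero; >-nonZero)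
import Data.Nat.Divisibility as ℕD
open import Data.Nat.Properties hiding (_<?_)
open import Algebra.Properties.CommutativeSemigroup +-commutativeSemigroup using (interchange)
open import Data.Nat.Tactic.RingSolver using () renaming (solve-∀ to ℕ-solve-∀)
open import Data.Product using (∃-syntax; _×_; _,_)
open import Data.Sum using (inj₁; inj₂)
open import Data.Vec using ([]; _∷_; here)
open import Function using (_∘_; id; flip)
open import Function.Bundles using (Equivalence)
open import Relation.Binary.PropositionalEquality
  using (_≡_; refl; sym; trans; cong; cong₂; subst; subst₂; module ≡-Reasoning)
open import Relation.Nullary using (¬_; yes; no; does; contradiction)
open import Relation.Nullary.Decidable
  using (T?; ¬?; dec-true; dec-false; decidable-stable; toWitness; isYes≗does)
open import Relation.Unary using (Decidable)

infixl 9 _↾_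
_↾_ : ∀ {n} {A : Set} → (Subset (suc n) → A) → Bool → Subset n → A
(p ↾ b) W = p (b ∷ W)

count : ∀ {n} → (Subset n → Bool) → ℕ
count {zero}  p = if p [] then 1 else 0
count {suc n} p = count (p ↾ outside) + count (p ↾ inside)

count-cong : ∀ {n} {p q : Subset n → Bool} → (∀ W → p W ≡ q W) → count p ≡ count q
count-cong {zero}  p≗q rewrite p≗q [] = refl
count-cong {suc n} p≗q = cong₂ _+_ (count-cong (p≗q ∘ (outside ∷_))) (count-cong (p≗q ∘ (inside ∷_)))

count-mono : ∀ {n} (p q : Subset n → Bool) → (∀ W → T (p W) → T (q W)) → count p ≤ count q
count-mono {zero} p q p⇒q with p [] | q [] | p⇒q []
... | false | _     | _   = z≤n
... | true  | true  | _   = ≤-refl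
... | true  | false | p⇒q = ⊥-elim (p⇒q _)
count-mono {suc n} p q p⇒q = +-mono-≤ (count-mono (p ↾ outside) (q ↾ outside) (p⇒q ∘ (outside ∷_)))
                                      (count-mono (p ↾ inside) (q ↾ inside) (p⇒q ∘ (inside ∷_)))

count-false : ∀ {n} → count {n} (λ _ → false) ≡ 0
count-false {zero}  = refl
count-false {suc n} = cong₂ _+_ (count-false {n}) (count-false {n})

count≤2^n : ∀ {n} (p : Subset n → Bool) → count p ≤ 2 ^ n
count≤2^n {zero} p with p []
... | false = z≤n
... | true  = ≤-refl
count≤2^n {suc n} p = begin
  count (p ↾ outside) + count (p ↾ inside) ≤⟨ +-mono-≤ (count≤2^n (p ↾ outside)) (count≤2^n (p ↾ inside)) ⟩
  2 ^ n + 2 ^ n                            ≡⟨ cong (2 ^ n +_) (+-identityʳ (2 ^ n)) ⟨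
  2 ^ suc n                                ∎
  where open ≤-Reasoning

count-∨ : ∀ {n} (p q : Subset n → Bool) → count (λ W → p W ∨ q W) ≤ count p + count q
count-∨ {zero} p q with p [] | q []
... | false | false = z≤n
... | false | true  = ≤-refl
... | true  | _     = s≤s z≤n
count-∨ {suc n} p q = begin
  count (λ W → p₀ W ∨ q₀ W) + count (λ W → p₁ W ∨ q₁ W) ≤⟨ +-mono-≤ (count-∨ p₀ q₀) (count-∨ p₁ q₁) ⟩
  (count p₀ + count q₀) + (count p₁ + count q₁)         ≡⟨ interchange (count p₀) (count q₀) _ _ ⟩
  count p + count q                                     ∎
  where
  open ≤-Reasoning
  p₀ = p ↾ outside; p₁ = p ↾ inside; q₀ = q ↾ outside; q₁ = q ↾ inside

count-split : ∀ {n} (p q : Subset n → Bool) →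
              count p ≡ count (λ W → p W ∧ q W) + count (λ W → p W ∧ not (q W))
count-split {zero} p q with p [] | q []
... | false | _     = refl
... | true  | true  = refl
... | true  | false = refl
count-split {suc n} p q = begin
  count p₀ + count p₁                                  ≡⟨ cong₂ _+_ (count-split p₀ q₀) (count-split p₁ q₁) ⟩
  (hit p₀ q₀ + miss p₀ q₀) + (hit p₁ q₁ + miss p₁ q₁) ≡⟨ interchange (hit p₀ q₀) (miss p₀ q₀) _ _ ⟩
  count (λ W → p W ∧ q W) + count (λ W → p W ∧ not (q W)) ∎
  where
  open ≡-Reasoning
  p₀ = p ↾ outside; p₁ = p ↾ inside; q₀ = q ↾ outside; q₁ = q ↾ inside
  hit miss : (Subset n → Bool) → (Subset n → Bool) → ℕ
  hit  r s = count (λ W → r W ∧ s W)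
  miss r s = count (λ W → r W ∧ not (s W))

length-filter-map : ∀ {A B : Set} {P : B → Set} (P? : Decidable P) (f : A → B) (xs : List A) →
                    length (filter P? (map f xs)) ≡ length (filter (P? ∘ f) xs)
length-filter-map P? f []       = refl
length-filter-map P? f (x ∷ xs) with does (P? (f x))
... | true  = cong suc (length-filter-map P? f xs)
... | false = length-filter-map P? f xs

length-filter-allSubsets : ∀ n {P : Subset n → Set} (P? : Decidable P) →
                           length (filter P? (allSubsets n)) ≡ count (λ W → does (P? W))
length-filter-allSubsets zero    P? with does (P? [])
... | true  = refl
... | false = refl
length-filter-allSubsets (suc n) P? = begin
  length (filter P? (W₀s ++ W₁s))                    ≡⟨ cong length (filter-++ P? W₀s W₁s) ⟩
  length (filter P? W₀s ++ filter P? W₁s)            ≡⟨ length-++ (filter P? W₀s) ⟩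
  length (filter P? W₀s) + length (filter P? W₁s)
    ≡⟨ cong₂ _+_ (trans (length-filter-map P? _ (allSubsets n)) (length-filter-allSubsets n _))
                 (trans (length-filter-map P? _ (allSubsets n)) (length-filter-allSubsets n _)) ⟩
  count (λ W → does (P? W))                          ∎
  where
  open ≡-Reasoning
  W₀s = map (outside ∷_) (allSubsets n)
  W₁s = map (inside ∷_) (allSubsets n)

Ignores : ∀ {n} {A : Set} → Subset n → (Subset n → A) → Set
Ignores F h = ∀ W → h W ≡ h (∁ F ∩ W)

Syndetic : ℕ → (ℕ → Bool) → Set
Syndetic e P = ∀ x → ∃[ j ] j ≤ e × T (P (j + x))

syndetic-zero : ∀ P → Syndetic 0 P → ∀ x → T (P x)
syndetic-zero P syn x with syn x
... | zero , _ , Px = Px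

syndetic-mono : ∀ {e e′} P → e ≤ e′ → Syndetic e P → Syndetic e′ P
syndetic-mono P e≤e′ syn x with syn x
... | j , j≤e , Pjx = j , ≤-trans j≤e e≤e′ , Pjx

syndetic-suc : ∀ {e} P → Syndetic e P → Syndetic e (P ∘ suc)
syndetic-suc P syn x with syn (suc x)
... | j , j≤e , Pjx = j , j≤e , subst (T ∘ P) (+-suc j x) Pjx

syndetic-∨-suc : ∀ {e} P → Syndetic (suc e) P → Syndetic e (λ y → P y ∨ P (suc y))
syndetic-∨-suc P syn x with syn x
... | zero  , _         , Px  = 0 , z≤n , Equivalence.from (T-∨ {P x}) (inj₁ Px)
... | suc j , s≤s j≤e   , Pjx = j , j≤e , Equivalence.from (T-∨ {P (j + x)}) (inj₂ Pjx)

+-mono-*-≤ : ∀ {a b k} x y → a ≤ x * k → b ≤ y * k → a + b ≤ (x + y) * k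
+-mono-*-≤ {k = k} x y a≤xk b≤yk = ≤-trans (+-mono-≤ a≤xk b≤yk) (≤-reflexive (sym (*-distribʳ-+ k x y)))

-- Each element of F splits the cube into two halves on which ∣ A ∩ W ∣ differs by one, and Q does
-- not see it; so one element of F is traded for the weaker target P y ∨ P (1 + y).
count≤count-hit*2^ : ∀ {n} e (A F : Subset n) {Q : Subset n → Bool} (P : ℕ → Bool) →
                     F ⊆ A → Ignores F Q → e ≤ ∣ F ∣ → Syndetic e P →
                     count Q ≤ count (λ W → Q W ∧ P ∣ A ∩ W ∣) * 2 ^ e
count≤count-hit*2^ zero A F {Q} P _ _ _ syn = begin
  count Q       ≤⟨ count-mono Q hit (λ W QW → Equivalence.from T-∧ (QW , syndetic-zero P syn _)) ⟩
  count hit     ≡⟨ *-identityʳ _ ⟨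
  count hit * 1 ∎
  where
  open ≤-Reasoning
  hit = λ W → Q W ∧ P ∣ A ∩ W ∣
count≤count-hit*2^ (suc e) [] [] _ _ _ () _
count≤count-hit*2^ (suc e) (outside ∷ A) (outside ∷ F) {Q} P F⊆A ign e≤∣F∣ syn =
  +-mono-*-≤ (count (λ W → (Q ↾ outside) W ∧ P ∣ A ∩ W ∣))
             (count (λ W → (Q ↾ inside) W ∧ P ∣ A ∩ W ∣))
    (count≤count-hit*2^ (suc e) A F P (drop-∷-⊆ F⊆A) (ign ∘ (outside ∷_)) e≤∣F∣ syn)
    (count≤count-hit*2^ (suc e) A F P (drop-∷-⊆ F⊆A) (ign ∘ (inside ∷_)) e≤∣F∣ syn)
count≤count-hit*2^ (suc e) (inside ∷ A) (outside ∷ F) {Q} P F⊆A ign e≤∣F∣ syn =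
  +-mono-*-≤ (count (λ W → (Q ↾ outside) W ∧ P ∣ A ∩ W ∣))
             (count (λ W → (Q ↾ inside) W ∧ P (suc ∣ A ∩ W ∣)))
    (count≤count-hit*2^ (suc e) A F P (drop-∷-⊆ F⊆A) (ign ∘ (outside ∷_)) e≤∣F∣ syn)
    (count≤count-hit*2^ (suc e) A F (P ∘ suc) (drop-∷-⊆ F⊆A) (ign ∘ (inside ∷_)) e≤∣F∣ (syndetic-suc P syn))
count≤count-hit*2^ (suc e) (outside ∷ A) (inside ∷ F) _ F⊆A _ _ _ = contradiction (F⊆A here) λ ()
count≤count-hit*2^ (suc e) (inside ∷ A) (inside ∷ F) {Q} P F⊆A ign (s≤s e≤∣F∣) syn = begin
  count Q₀ + count Q₁                   ≡⟨ cong (count Q₀ +_) (count-cong Q₁≗Q₀) ⟩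
  count Q₀ + count Q₀                   ≤⟨ +-mono-≤ IH IH ⟩
  (h₀ + h₁) * 2 ^ e + (h₀ + h₁) * 2 ^ e ≡⟨ double (h₀ + h₁) (2 ^ e) ⟩
  (h₀ + h₁) * 2 ^ suc e                 ∎
  where
  open ≤-Reasoning
  Q₀ = Q ↾ outside
  Q₁ = Q ↾ inside
  Q₁≗Q₀ : ∀ W → Q₁ W ≡ Q₀ W
  Q₁≗Q₀ W = trans (ign (inside ∷ W)) (sym (ign (outside ∷ W)))
  h₀ = count (λ W → Q₀ W ∧ P ∣ A ∩ W ∣)
  h₁ = count (λ W → Q₁ W ∧ P (suc ∣ A ∩ W ∣))
  hit-either : count (λ W → Q₀ W ∧ (P ∣ A ∩ W ∣ ∨ P (suc ∣ A ∩ W ∣))) ≤ h₀ + h₁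
  hit-either = ≤-trans (≤-reflexive (count-cong distrib))
                       (count-∨ (λ W → Q₀ W ∧ P ∣ A ∩ W ∣) (λ W → Q₁ W ∧ P (suc ∣ A ∩ W ∣)))
    where
    distrib : ∀ W → Q₀ W ∧ (P ∣ A ∩ W ∣ ∨ P (suc ∣ A ∩ W ∣))
                  ≡ (Q₀ W ∧ P ∣ A ∩ W ∣) ∨ (Q₁ W ∧ P (suc ∣ A ∩ W ∣))
    distrib W rewrite Q₁≗Q₀ W = ∧-distribˡ-∨ (Q₀ W) _ _
  IH : count Q₀ ≤ (h₀ + h₁) * 2 ^ e
  IH = ≤-trans (count≤count-hit*2^ e A F (λ y → P y ∨ P (suc y)) (drop-∷-⊆ F⊆A) (ign ∘ (outside ∷_)) e≤∣F∣
                                   (syndetic-∨-suc P syn))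
               (*-monoˡ-≤ (2 ^ e) hit-either)
  double : ∀ x y → x * y + x * y ≡ x * (2 * y)
  double x y = sym (trans (*-distribˡ-+ x y (y + 0)) (cong (λ z → x * y + x * z) (+-identityʳ y)))

count-miss : ∀ {n} e (A F : Subset n) {Q : Subset n → Bool} (P : ℕ → Bool) →
             F ⊆ A → Ignores F Q → e ≤ ∣ F ∣ → Syndetic e P →
             count (λ W → Q W ∧ not (P ∣ A ∩ W ∣)) * 2 ^ e ≤ count Q * pred (2 ^ e)
count-miss e A F {Q} P F⊆A ign e≤∣F∣ syn = begin
  miss * 2 ^ e           ≡⟨ cong (miss *_) 1+p≡2^e ⟨
  miss * suc p           ≤⟨ complement hit miss p (subst₂ _≤_ (count-split Q (P ∘ ∣_∣ ∘ (A ∩_)))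
                                                   (cong (hit *_) (sym 1+p≡2^e))
                                                   (count≤count-hit*2^ e A F P F⊆A ign e≤∣F∣ syn)) ⟩
  (hit + miss) * p       ≡⟨ cong (_* p) (count-split Q (P ∘ ∣_∣ ∘ (A ∩_))) ⟨
  count Q * p            ∎
  where
  open ≤-Reasoning
  p = pred (2 ^ e)
  1+p≡2^e : suc p ≡ 2 ^ e
  1+p≡2^e = suc-pred (2 ^ e) {{m^n≢0 2 e}}
  hit  = count (λ W → Q W ∧ P ∣ A ∩ W ∣)
  miss = count (λ W → Q W ∧ not (P ∣ A ∩ W ∣))
  complement : ∀ h m p → h + m ≤ h * suc p → m * suc p ≤ (h + m) * p
  complement h m p h+m≤h[1+p] = begin
    m * suc p   ≡⟨ *-suc m p ⟩
    m + m * p   ≤⟨ +-monoˡ-≤ (m * p) (+-cancelˡ-≤ h m (h * p) (subst (h + m ≤_) (*-suc h p) h+m≤h[1+p])) ⟩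
    h * p + m * p ≡⟨ *-distribʳ-+ p h m ⟨
    (h + m) * p ∎

p⊆q⇒p∩q≡p : ∀ {n} {p q : Subset n} → p ⊆ q → p ∩ q ≡ p
p⊆q⇒p∩q≡p {p = p} {q} p⊆q = ⊆-antisym (p∩q⊆p p q) (λ x∈p → x∈p∩q⁺ (x∈p , p⊆q x∈p))

ignores-∣∩∣ : ∀ {n} {A F : Subset n} → A ⊆ ∁ F → Ignores F (λ W → ∣ A ∩ W ∣)
ignores-∣∩∣ {A = A} {F} A⊆∁F W = cong ∣_∣ (begin
  A ∩ W           ≡⟨ cong (_∩ W) (p⊆q⇒p∩q≡p A⊆∁F) ⟨
  (A ∩ ∁ F) ∩ W   ≡⟨ ∩-assoc A (∁ F) W ⟩
  A ∩ (∁ F ∩ W)   ∎)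
  where open ≡-Reasoning

every : ∀ {L} → (Fin L → Bool) → Bool
every {zero}  f = true
every {suc L} f = every (f ∘ inject₁) ∧ f (fromℕ L)

every-cong : ∀ {L} {f g : Fin L → Bool} → (∀ i → f i ≡ g i) → every f ≡ every g
every-cong {zero}  f≗g = refl
every-cong {suc L} f≗g = cong₂ _∧_ (every-cong (f≗g ∘ inject₁)) (f≗g (fromℕ L))

every⁺ : ∀ {L} (f : Fin L → Bool) → (∀ i → T (f i)) → T (every f)
every⁺ {zero}  f _  = _
every⁺ {suc L} f Tf = Equivalence.from T-∧ (every⁺ (f ∘ inject₁) (Tf ∘ inject₁) , Tf (fromℕ L))

inject₁<fromℕ : ∀ {L} (i : Fin L) → inject₁ i Fin.< fromℕ L
inject₁<fromℕ {L} i = subst (toℕ (inject₁ i) <_) (sym (toℕ-fromℕ L)) (inject₁ℕ< i)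

inject₁-mono-< : ∀ {L} {i j : Fin L} → j Fin.< i → inject₁ j Fin.< inject₁ i
inject₁-mono-< {i = i} {j} = subst₂ _<_ (sym (toℕ-inject₁ j)) (sym (toℕ-inject₁ i))

count-every-miss : ∀ {n e} L (A F : Fin L → Subset n) (P : ℕ → Bool) →
                   (∀ i → F i ⊆ A i) → (∀ {i j} → j Fin.< i → A j ⊆ ∁ (F i)) →
                   (∀ i → e ≤ ∣ F i ∣) → Syndetic e P →
                   count (λ W → every (λ i → not (P ∣ A i ∩ W ∣))) * (2 ^ e) ^ L ≤ pred (2 ^ e) ^ L * 2 ^ n
count-every-miss {n} zero A F P _ _ _ _ = begin
  count {n} (λ _ → true) * 1 ≡⟨ *-identityʳ _ ⟩
  count {n} (λ _ → true)     ≤⟨ count≤2^n {n} (λ _ → true) ⟩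
  2 ^ n                      ≡⟨ *-identityˡ (2 ^ n) ⟨
  1 * 2 ^ n                  ∎
  where open ≤-Reasoning
count-every-miss {n} {e} (suc L) A F P F⊆A Aj⊆∁Fi e≤∣F∣ syn = begin
  miss * (q * q ^ L)                                        ≡⟨ *-assoc miss q (q ^ L) ⟨
  miss * q * q ^ L
    ≤⟨ *-monoˡ-≤ (q ^ L) (count-miss e (A last) (F last) P (F⊆A last) ignores (e≤∣F∣ last) syn) ⟩
  count Q * p * q ^ L                                       ≡⟨ cong (_* q ^ L) (*-comm (count Q) p) ⟩
  p * count Q * q ^ L                                       ≡⟨ *-assoc p (count Q) (q ^ L) ⟩
  p * (count Q * q ^ L)
    ≤⟨ *-monoʳ-≤ p (count-every-miss L (A ∘ inject₁) (F ∘ inject₁) P (F⊆A ∘ inject₁)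
                       (Aj⊆∁Fi ∘ inject₁-mono-<) (e≤∣F∣ ∘ inject₁) syn) ⟩
  p * (p ^ L * 2 ^ n)                                       ≡⟨ *-assoc p (p ^ L) (2 ^ n) ⟨
  p ^ suc L * 2 ^ n                                         ∎
  where
  open ≤-Reasoning
  q = 2 ^ e
  p = pred q
  last = fromℕ L
  Q : Subset n → Bool
  Q W = every (λ i → not (P ∣ A (inject₁ i) ∩ W ∣))
  miss = count (λ W → Q W ∧ not (P ∣ A last ∩ W ∣))
  ignores : Ignores (F last) Q
  ignores W = every-cong λ i →
    cong (not ∘ P) (ignores-∣∩∣ (Aj⊆∁Fi (inject₁<fromℕ i)) W)

multiple-within : ∀ m′ z → ∃[ j ] j ≤ m′ × suc m′ ℕD.∣ j + z
multiple-within m′ zero = 0 , z≤n , (suc m′ ℕD.∣0)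
multiple-within m′ (suc z) with multiple-within m′ z
... | suc j , j<m′ , m∣j+z = j , <⇒≤ j<m′ , subst (suc m′ ℕD.∣_) (sym (+-suc j z)) m∣j+z
... | zero  , _    , m∣z   = m′ , ≤-refl ,
  subst (suc m′ ℕD.∣_) (sym (+-suc m′ z)) (ℕD.∣m∣n⇒∣m+n ℕD.∣-refl m∣z)

∣+*⇒≡[mod] : ∀ {m′ x k} → suc m′ ℕD.∣ x + m′ * k → x ≡ k [mod suc m′ ]
∣+*⇒≡[mod] {m′} {x} {k} m∣x+m′k = ∣⇒∣ᵤ (subst (ℤ.+ suc m′ ∣_) difference
  (∣m∣n⇒∣m-n (∣ᵤ⇒∣ {i = ℤ.+ (x + m′ * k)} m∣x+m′k) (∣m⇒∣m*n (ℤ.+ k) ∣-refl)))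
  where
  difference : ℤ.+ (x + m′ * k) ℤ.- ℤ.+ suc m′ ℤ.* ℤ.+ k ≡ ℤ.+ x ℤ.- ℤ.+ k
  difference = trans (cong₂ (λ a b → a ℤ.- b ℤ.* ℤ.+ k)
                            (trans (pos-+ x (m′ * k)) (cong (ℤ._+_ (ℤ.+ x)) (pos-* m′ k)))
                            (pos-+ 1 m′))
                     (ring (ℤ.+ x) (ℤ.+ m′) (ℤ.+ k))
    where
    ring : ∀ X M K → (X ℤ.+ M ℤ.* K) ℤ.- (ℤ.+ 1 ℤ.+ M) ℤ.* K ≡ X ℤ.- K
    ring = solve-∀

_≡ᵇ_[mod_] : ℕ → ℕ → ℕ → Bool
x ≡ᵇ k [mod m ] = does (x ≡? k [mod m ])

≡[mod]-syndetic : ∀ k m′ → Syndetic m′ (_≡ᵇ k [mod suc m′ ])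
≡[mod]-syndetic k m′ x with multiple-within m′ (x + m′ * k)
... | j , j≤m′ , m∣j+[x+m′k] = j , j≤m′ , Equivalence.from T-≡ (dec-true ((j + x) ≡? k [mod suc m′ ])
  (∣+*⇒≡[mod] (subst (suc m′ ℕD.∣_) (sym (+-assoc j x (m′ * k))) m∣j+[x+m′k])))

count-any : ∀ {n} {I : Set} (p : I → Subset n → Bool) (xs : List I) {c X : ℕ} →
            (∀ x → x ∈ˡ xs → count (p x) * c ≤ X) →
            count (λ W → any (λ x → p x W) xs) * c ≤ length xs * X
count-any {n} p []       {c}     _     = ≤-reflexive (cong (_* c) (count-false {n}))
count-any p (x ∷ xs) {c} {X} bound = begin
  count (λ W → p x W ∨ any (λ y → p y W) xs) * c                ≤⟨ *-monoˡ-≤ c (count-∨ (p x) _) ⟩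
  (count (p x) + count (λ W → any (λ y → p y W) xs)) * c        ≡⟨ *-distribʳ-+ c (count (p x)) _ ⟩
  count (p x) * c + count (λ W → any (λ y → p y W) xs) * c
    ≤⟨ +-mono-≤ (bound x (Any.here refl)) (count-any p xs (λ y → bound y ∘ Any.there)) ⟩
  X + length xs * X                                             ∎
  where open ≤-Reasoning

bernoulli : ∀ p L → p ^ L * (p + L) ≤ suc p ^ L * p
bernoulli p zero = ≤-reflexive (+-identityʳ (p + 0))
bernoulli p (suc L) = begin
  p * p ^ L * (p + suc L)            ≡⟨ ring₁ p (p ^ L) L ⟩
  p * (p ^ L * (p + L)) + p * p ^ L
    ≤⟨ +-mono-≤ (*-monoʳ-≤ p (bernoulli p L)) (*-monoʳ-≤ p (^-monoˡ-≤ L (n≤1+n p))) ⟩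
  p * (suc p ^ L * p) + p * suc p ^ L ≡⟨ ring₂ p (suc p ^ L) ⟩
  suc p * suc p ^ L * p              ∎
  where
  open ≤-Reasoning
  ring₁ : ∀ p x L → p * x * (p + suc L) ≡ p * (x * (p + L)) + p * x
  ring₁ = ℕ-solve-∀
  ring₂ : ∀ p y → p * (y * p) + p * y ≡ suc p * y * p
  ring₂ = ℕ-solve-∀

M*p^[pM]≤[1+p]^[pM] : ∀ p M .{{_ : NonZero p}} → M * p ^ (p * M) ≤ suc p ^ (p * M)
M*p^[pM]≤[1+p]^[pM] p M = begin
  M * p ^ L      ≤⟨ *-monoˡ-≤ (p ^ L) (n≤1+n M) ⟩
  suc M * p ^ L  ≡⟨ *-comm (suc M) (p ^ L) ⟩
  p ^ L * suc M  ≤⟨ *-cancelˡ-≤ p (subst₂ _≤_ (ring p (p ^ L) M) (*-comm (suc p ^ L) p) (bernoulli p L)) ⟩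
  suc p ^ L      ∎
  where
  open ≤-Reasoning
  L = p * M
  ring : ∀ p x M → x * (p + p * M) ≡ p * (x * suc M)
  ring = ℕ-solve-∀

rescale : ∀ x N r {c t b a} .{{_ : NonZero c}} →
          x * c ≤ N * (r * t) → N * b * r ≤ c → 1 ≤ a → x * b ≤ a * t
rescale x N r {c} {t} {b} {a} x*c≤N*r*t N*b*r≤c 1≤a = *-cancelʳ-≤ (x * b) (a * t) c (begin
  x * b * c         ≡⟨ ring₁ x b c ⟩
  x * c * b         ≤⟨ *-monoˡ-≤ b x*c≤N*r*t ⟩
  N * (r * t) * b   ≡⟨ ring₂ N r t b ⟩
  N * b * r * t     ≤⟨ *-monoˡ-≤ t N*b*r≤c ⟩
  c * t             ≡⟨ trans (*-comm c t) (cong (_* c) (sym (*-identityˡ t))) ⟩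
  1 * t * c         ≤⟨ *-monoˡ-≤ c (*-monoˡ-≤ t 1≤a) ⟩
  a * t * c         ∎)
  where
  open ≤-Reasoning
  ring₁ : ∀ x b c → x * b * c ≡ x * c * b
  ring₁ = ℕ-solve-∀
  ring₂ : ∀ N r t b → N * (r * t) * b ≡ N * b * r * t
  ring₂ = ℕ-solve-∀

⊆-⋃ : ∀ {n} {p : Subset n} {ps : List (Subset n)} → p ∈ˡ ps → p ⊆ ⋃ ps
⊆-⋃ {ps = p ∷ ps} (Any.here refl) = p⊆p∪q (⋃ ps)
⊆-⋃ {ps = q ∷ ps} (Any.there p∈ps) = q⊆p∪q q (⋃ ps) ∘ ⊆-⋃ p∈ps

S⊆N : ∀ G {L} (u : Fin L → Fin (n₁ G)) i → S G u i ⊆ N G (u i)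
S⊆N G u i = p∩q⊆p _ _

N⊆∁S : ∀ G {L} (u : Fin L → Fin (n₁ G)) {i j} → j Fin.< i → N G (u j) ⊆ ∁ (S G u i)
N⊆∁S G u {i} {j} j<i x∈Nj = x∉p⇒x∈∁p λ x∈Si →
  x∈∁p⇒x∉p (p∩q⊆q _ _ x∈Si)
    (⊆-⋃ (∈-map⁺ (N G ∘ u) (∈-filter⁺ (_<? i) (∈-allFin j) j<i)) x∈Nj)

misses : ∀ G {L} (u : Fin L → Fin (n₁ G)) (k m : ℕ) → Subset (n₂ G) → Bool
misses G u k m W = every (λ i → not (∣ N G (u i) ∩ W ∣ ≡ᵇ k [mod m ]))

missesSome : ∀ (d : ℕ) G {L} (u : Fin L → Fin (n₁ G)) → Subset (n₂ G) → Bool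
missesSome d G u W = any (λ k → any (λ m′ → misses G u k (suc m′) W) (upTo d)) (upTo (suc d))

¬missesSome⇒good : ∀ d G {L} (u : Fin L → Fin (n₁ G)) W → ¬ T (missesSome d G u W) → Good d G u W
¬missesSome⇒good d G u W ¬some k zero _ () _
¬missesSome⇒good d G u W ¬some k (suc m′) k≤m _ m≤d
  with any? (λ i → ∣ N G (u i) ∩ W ∣ ≡? k [mod suc m′ ])
... | yes hit = hit
... | no ¬hit = contradiction
  (any⁺ _ (lose (∈-upTo⁺ (s≤s (≤-trans k≤m m≤d)))
    (any⁺ _ (lose (∈-upTo⁺ m≤d)
      (every⁺ _ λ i → Equivalence.from T-not-≡ (dec-false (_ ≡? k [mod suc m′ ]) (¬hit ∘ (i ,_))))))))
  ¬some

count-missesSome : ∀ d G {L} (u : Fin L → Fin (n₁ G)) → (∀ i → d ≤ ∣ S G u i ∣) →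
                   count (missesSome d G u) * (2 ^ d) ^ L ≤ suc d * d * (pred (2 ^ d) ^ L * 2 ^ n₂ G)
count-missesSome d G {L} u d≤∣S∣ = flip ≤-trans (≤-reflexive events)
  (count-any (λ k W → any (λ m′ → misses G u k (suc m′) W) (upTo d)) (upTo (suc d)) λ k _ →
   count-any (λ m′ → misses G u k (suc m′)) (upTo d) λ m′ m′∈ →
     count-every-miss L (N G ∘ u) (S G u) (_≡ᵇ k [mod suc m′ ]) (S⊆N G u) (N⊆∁S G u) d≤∣S∣
       (syndetic-mono (_≡ᵇ k [mod suc m′ ]) (<⇒≤ (∈-upTo⁻ m′∈)) (≡[mod]-syndetic k m′)))
  where
  X = pred (2 ^ d) ^ L * 2 ^ n₂ G
  events : length (upTo (suc d)) * (length (upTo d) * X) ≡ suc d * d * X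
  events = trans (cong₂ (λ s t → s * (t * X)) (length-applyUpTo id (suc d)) (length-applyUpTo id d))
                 (sym (*-assoc (suc d) d X))

#bad≤count-missesSome : ∀ d G {L} (u : Fin L → Fin (n₁ G)) → #bad d G u ≤ count (missesSome d G u)
#bad≤count-missesSome d G u = begin
  #bad d G u                              ≡⟨ length-filter-allSubsets (n₂ G) (¬? ∘ good? d G u) ⟩
  count (λ W → does (¬? (good? d G u W))) ≤⟨ count-mono _ (missesSome d G u) bad⇒missesSome ⟩
  count (missesSome d G u)                ∎
  where
  open ≤-Reasoning
  bad⇒missesSome : ∀ W → T (does (¬? (good? d G u W))) → T (missesSome d G u W)
  bad⇒missesSome W bad = decidable-stable (T? _) (¬good ∘ ¬missesSome⇒good d G u W)
    where
    ¬good : ¬ Good d G u W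
    ¬good = toWitness (subst T (sym (isYes≗does (¬? (good? d G u W)))) bad)

lemma3p5 : ∀ (d : ℕ) → 1 < d →
           ∀ (a b : ℕ) → 1 ≤ a → 1 ≤ b →
           ∃[ L ] ∃[ D ] (1 ≤ L × 1 ≤ D ×
             (∀ (G : BipartiteGraph) (u : Fin L → Fin (n₁ G)) →
                (∀ i → D ≤ ∣ S G u i ∣) →
                #bad d G u * b ≤ a * 2 ^ n₂ G))
lemma3p5 d 1<d a b 1≤a 1≤b = L , d , 1≤L , <⇒≤ 1<d , λ G u d≤∣S∣ →
  rescale (#bad d G u) (suc d * d) (p ^ L)
    (≤-trans (*-monoˡ-≤ ((2 ^ d) ^ L) (#bad≤count-missesSome d G u)) (count-missesSome d G u d≤∣S∣))
    (subst (M * p ^ L ≤_) (cong (_^ L) (suc-pred (2 ^ d))) (M*p^[pM]≤[1+p]^[pM] p M))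
    1≤a
  where
  p = pred (2 ^ d)
  M = suc d * d * b
  L = p * M
  1≤p : 1 ≤ p
  1≤p = pred-mono-≤ (^-monoʳ-≤ 2 (<⇒≤ 1<d))
  1≤L : 1 ≤ L
  1≤L = *-mono-≤ 1≤p (*-mono-≤ (*-mono-≤ {1} {suc d} (s≤s z≤n) (<⇒≤ 1<d)) 1≤b)
  instance
    2^d≢0 : NonZero (2 ^ d)
    2^d≢0 = m^n≢0 2 d
    [2^d]^L≢0 : NonZero ((2 ^ d) ^ L)
    [2^d]^L≢0 = m^n≢0 (2 ^ d) L
    p≢0 : NonZero p
    p≢0 = >-nonZero 1≤p
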